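{- Let $S$ be a finite satisfiable set of propositional clauses. Consider any sequence of variable-assignment steps. Let $A$ be the current partial assignment immediately before some step $t$. At step $t$, a variable $x$ not assigned by $A$ receives a truth value, producing the partial assignment $A'$. Suppose that $\tilde{S}(A)$ is nonempty and that $A'$ satisfies every clause of $S$, so that $\tilde{S}(A')=\emptyset$. Then $\tilde{S}(A)$ is unipolar. Consequently, the set of active clauses becomes unipolar strictly before all clauses of $S$ are satisfied. Hence unipolar set termination (UST), which halts as soon as the active set is unipolar, is reached in fewer assignment steps than all-satisfied termination (AST), which halts when all clauses of $S$ are satisfied.
   Context: A literal is a variable $v$ or its negation $\neg v$. A clause is a finite set (disjunction) of literals. A partial assignment $A$ assigns truth values to some of the variables. A clause is satisfied by $A$ if it contains a literal that is true under $A$. The set of \emph{active clauses} under $A$ is defined as $$\tilde{S}(A)=\{\,C\setminus\{\text{literals false under }A\} : C\in S,\ C \text{ contains no literal true under } A\,\}.$$ That is, it consists of the not-yet-satisfied clauses of $S$, each with its falsified literals deleted. A clause is \emph{positive} if all its literals are unnegated and \emph{negative} if all its literals are negated. These conditions are read vacuously for the empty clause. A set of clauses is \emph{bipolar} if it contains both a positive clause and a negative clause, and \emph{unipolar} otherwise. -}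

module Defs where

open import Data.Nat using (ℕ; _≡ᵇ_)
open import Data.Bool using (Bool; true; false; not; if_then_else_)
open import Data.Maybe using (Maybe; just; nothing)
open import Data.List using (List; map; filterᵇ)
open import Data.Bool.ListAction using (any)
open import Data.List.Relation.Unary.All using (All)
open import Data.List.Relation.Unary.Any using (Any)
open import Data.Product using (Σ)
open import Relation.Binary.PropositionalEquality using (_≡_)
open import Relation.Nullary using (¬_)

Var : Set
Var = ℕ

-- A literal: a variable together with a polarity (true = unnegated v, false = ¬ v).
record Literal : Set where
  constructor lit
  field
    var      : Var
    polarity : Bool
open Literal public

Clause : Set
Clause = List Literal

ClauseSet : Set
ClauseSet = List Clause

-- Partial assignment: nothing = unassigned.
PartialAssignment : Set
PartialAssignment = Var → Maybe Bool

TotalAssignment : Set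
TotalAssignment = Var → Bool

eqBool : Bool → Bool → Bool
eqBool true  b = b
eqBool false b = not b

trueUnder : PartialAssignment → Literal → Bool
trueUnder A l with A (var l)
... | nothing = false
... | just b  = eqBool b (polarity l)

falseUnder : PartialAssignment → Literal → Bool
falseUnder A l with A (var l)
... | nothing = false
... | just b  = not (eqBool b (polarity l))

Satisfied : PartialAssignment → Clause → Set
Satisfied A C = Any (λ l → trueUnder A l ≡ true) C

-- Active clauses S̃(A): unsatisfied clauses with their false literals removed.
active : PartialAssignment → ClauseSet → ClauseSet
active A S = map (filterᵇ (λ l → not (falseUnder A l)))
                 (filterᵇ (λ C → not (any (trueUnder A) C)) S)

evalLit : TotalAssignment → Literal → Bool
evalLit σ l = eqBool (σ (var l)) (polarity l)

Satisfiable : ClauseSet → Set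
Satisfiable S = Σ TotalAssignment (λ σ → All (λ C → Any (λ l → evalLit σ l ≡ true) C) S)

-- Positive / negative clauses (vacuous for the empty clause).
PositiveClause : Clause → Set
PositiveClause C = All (λ l → polarity l ≡ true) C

NegativeClause : Clause → Set
NegativeClause C = All (λ l → polarity l ≡ false) C

Bipolar : ClauseSet → Set
Bipolar S = Σ (Any PositiveClause S) (λ _ → Any NegativeClause S)

Unipolar : ClauseSet → Set
Unipolar S = ¬ Bipolar S

assign : PartialAssignment → Var → Bool → PartialAssignment
assign A x b y = if y ≡ᵇ x then just b else A y

Step : PartialAssignment → PartialAssignment → Set
Step A A' = Σ Var (λ x → Σ Bool (λ b → Σ (A x ≡ nothing) (λ _ → A' ≡ assign A x b)))

-- Suppose the last step sets an unassigned variable x to b and thereby satisfies every clause.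
-- A clause not yet satisfied before that step can only become satisfied through a literal
-- on x of polarity b; being unassigned before the step, that literal survives in the active
-- clause.  Hence every active clause contains a literal of polarity b, which excludes an
-- active clause all of whose literals have the opposite polarity.  The step before all
-- clauses are satisfied exists because the active set is nonempty at the start.
module Submission where

open import Defs
open import Data.Nat using (ℕ; zero; suc; _<_; _≟_; _≡ᵇ_)
open import Data.Nat.Properties using (≡⇒≡ᵇ; ≡ᵇ⇒≡; n<1+n)
open import Data.Bool using (Bool; true; false; not; T)
open import Data.Bool.Properties using (T?; T-≡; T-not-≡; ¬-not)
open import Data.Bool.ListAction using (any)
open import Data.Maybe using (just; nothing)
open import Data.List using ([]; map; filterᵇ)
open import Data.List.Properties using (filter-none)
open import Data.List.Membership.Propositional using (_∈_; lose; find)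
open import Data.List.Membership.Propositional.Properties using (∈-map⁻; ∈-filter⁺; ∈-filter⁻)
open import Data.List.Relation.Unary.All as All using (All)
open import Data.List.Relation.Unary.Any as Any using (Any)
open import Data.List.Relation.Unary.Any.Properties using (any⁺)
open import Data.Product using (_×_; ∃; _,_)
open import Function using (_∘_; Equivalence)
open import Relation.Binary.PropositionalEquality using (_≡_; _≢_; refl; sym; trans; cong; subst)
open import Relation.Nullary using (¬_; yes; no; contradiction)

eqBool⇒≡ : ∀ b c → eqBool b c ≡ true → b ≡ c
eqBool⇒≡ true  true  _ = refl
eqBool⇒≡ false false _ = refl

assign-self : ∀ A x b → assign A x b x ≡ just b
assign-self A x b rewrite Equivalence.to T-≡ (≡⇒≡ᵇ x x refl) = refl

assign-other : ∀ A x b {y} → y ≢ x → assign A x b y ≡ A y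
assign-other A x b {y} y≢x with y ≡ᵇ x in eq
... | true  = contradiction (≡ᵇ⇒≡ y x (Equivalence.from T-≡ eq)) y≢x
... | false = refl

trueUnder-cong : ∀ {A A′} l → A (var l) ≡ A′ (var l) → trueUnder A l ≡ trueUnder A′ l
trueUnder-cong l eq rewrite eq = refl

falseUnder-unassigned : ∀ A l → A (var l) ≡ nothing → falseUnder A l ≡ false
falseUnder-unassigned A l eq rewrite eq = refl

trueUnder-assign⁻ : ∀ A x b l → trueUnder (assign A x b) l ≡ true → trueUnder A l ≡ false →
  var l ≡ x × polarity l ≡ b
trueUnder-assign⁻ A x b (lit v p) t f with v ≟ x
... | yes refl rewrite assign-self A v b = refl , sym (eqBool⇒≡ b p t)
... | no v≢x with () ← trans (sym t) (trans (trueUnder-cong {assign A x b} {A} (lit v p) (assign-other A x b v≢x)) f)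

any-≡true⁺ : ∀ {A : Set} (p : A → Bool) {xs} → Any (λ x → p x ≡ true) xs → any p xs ≡ true
any-≡true⁺ p = Equivalence.to T-≡ ∘ any⁺ p ∘ Any.map (Equivalence.from T-≡)

any-false⇒false : ∀ {A : Set} (p : A → Bool) {x xs} → x ∈ xs → any p xs ≡ false → p x ≡ false
any-false⇒false p x∈xs any≡false = ¬-not λ px≡true →
  contradiction (trans (sym (any-≡true⁺ p (lose x∈xs px≡true))) any≡false) λ ()

residual-has-polarity : ∀ A x b C → A x ≡ nothing →
  Satisfied (assign A x b) C → any (trueUnder A) C ≡ false →
  Any (λ l → polarity l ≡ b) (filterᵇ (λ l → not (falseUnder A l)) C)
residual-has-polarity A x b C Ax≡nothing sat unsat with find sat
... | l , l∈C , l-true with trueUnder-assign⁻ A x b l l-true (any-false⇒false (trueUnder A) l∈C unsat)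
... | refl , pol≡b =
  lose (∈-filter⁺ (T? ∘ λ k → not (falseUnder A k)) l∈C
                  (Equivalence.from T-not-≡ (falseUnder-unassigned A l Ax≡nothing)))
       pol≡b

active-has-polarity : ∀ A x b S → A x ≡ nothing → All (Satisfied (assign A x b)) S →
  All (Any (λ l → polarity l ≡ b)) (active A S)
active-has-polarity A x b S Ax≡nothing sat = All.tabulate λ C′∈active →
  let C , C∈unsat , C′≡residual = ∈-map⁻ _ C′∈active
      C∈S , unsat = ∈-filter⁻ (T? ∘ λ C → not (any (trueUnder A) C)) C∈unsat
  in subst (Any _) (sym C′≡residual)
       (residual-has-polarity A x b C Ax≡nothing (All.lookup sat C∈S) (Equivalence.to T-not-≡ unsat))

allSatisfied⇒active≡[] : ∀ A S → All (Satisfied A) S → active A S ≡ []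
allSatisfied⇒active≡[] A S sat =
  cong (map _) (filter-none (T? ∘ λ C → not (any (trueUnder A) C)) (All.map unsatisfied-fails sat))
  where
  unsatisfied-fails : ∀ {C} → Satisfied A C → ¬ T (not (any (trueUnder A) C))
  unsatisfied-fails sat-C unsat =
    contradiction (trans (sym (any-≡true⁺ (trueUnder A) sat-C)) (Equivalence.to T-not-≡ unsat)) λ ()

polarity-forced : ∀ {b c} {L : ClauseSet} →
  All (Any (λ l → polarity l ≡ b)) L → Any (All (λ l → polarity l ≡ c)) L → b ≡ c
polarity-forced hasB someAllC with All.lookupAny hasB someAllC
... | someB , allC with All.lookupAny allC someB
... | pol≡c , pol≡b = trans (sym pol≡b) pol≡c

allClausesHavePolarity⇒unipolar : ∀ {b} {L : ClauseSet} →
  All (Any (λ l → polarity l ≡ b)) L → Unipolar L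
allClausesHavePolarity⇒unipolar hasB (positive , negative) =
  contradiction (trans (sym (polarity-forced hasB positive)) (polarity-forced hasB negative)) λ ()

lastStep-unipolar : ∀ S A x b → A x ≡ nothing → All (Satisfied (assign A x b)) S →
  Unipolar (active A S)
lastStep-unipolar S A x b Ax≡nothing sat =
  allClausesHavePolarity⇒unipolar (active-has-polarity A x b S Ax≡nothing sat)

unipolar-before-allSatisfied : ∀ S (seq : ℕ → PartialAssignment) →
  (∀ t → Step (seq t) (seq (suc t))) → (n : ℕ) →
  active (seq 0) S ≢ [] → All (Satisfied (seq n)) S →
  ∃ λ k → k < n × Unipolar (active (seq k) S)
unipolar-before-allSatisfied S seq steps zero nonempty sat =
  contradiction (allSatisfied⇒active≡[] (seq 0) S sat) nonempty
unipolar-before-allSatisfied S seq steps (suc m) nonempty sat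
  with x , b , unassigned , seq[1+m]≡assign ← steps m =
  m , n<1+n m ,
  lastStep-unipolar S (seq m) x b unassigned (subst (λ A → All (Satisfied A) S) seq[1+m]≡assign sat)

proposition2p1 : (S : ClauseSet) → Satisfiable S →
    ((A : PartialAssignment) (x : Var) (b : Bool) → A x ≡ nothing →
      active A S ≢ [] → All (Satisfied (assign A x b)) S →
      Unipolar (active A S))
    ×
    ((seq : ℕ → PartialAssignment) → (∀ t → Step (seq t) (seq (suc t))) →
      (n : ℕ) → active (seq 0) S ≢ [] → All (Satisfied (seq n)) S →
      ∃ λ k → k < n × Unipolar (active (seq k) S))
proposition2p1 S _ =
  (λ A x b unassigned _ → lastStep-unipolar S A x b unassigned) ,
  unipolar-before-allSatisfied S
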